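{- Let $G$ be an incidence hypergraph and $S$ a set. The Frobenius morphism $\Phi_I:I^{\diamond}(I(G)\times S)\to G\times I^{\diamond}(S)$ is given by $\Phi_I=(\varsigma_G\times\mathrm{id}_S,\ \omega_G\times\mathrm{id}_S,\ \mathrm{id}_{I(G)\times S})$ (components listed as vertex, edge, incidence maps). Moreover, $(I^{\diamond},I,I^{\star})$ is an essential geometric embedding from $\mathbf{Set}$ to $\mathfrak{R}$ which is neither a surjection nor atomic.
   Context: An incidence hypergraph $G$ consists of sets $\check V(G)$, $\check E(G)$, $I(G)$ and functions $\varsigma_G:I(G)\to\check V(G)$, $\omega_G:I(G)\to\check E(G)$; a morphism is a triple of functions $(\check V(\phi),\check E(\phi),I(\phi))$ commuting with $\varsigma$ and $\omega$; this is the presheaf topos $\mathfrak{R}$, with products computed componentwise. $I:\mathfrak{R}\to\mathbf{Set}$ is the incidence functor, with left adjoint $I^{\diamond}(X)=(X,X,X,\mathrm{id}_X,\mathrm{id}_X)$ (vertices, edges, incidences all $X$, both maps identity) and right adjoint $I^{\star}(X)$ with one vertex, one edge and incidence set $X$. For an adjunction $L\dashv F$ with $F$ preserving products and counit $\varepsilon$, the Frobenius morphism $L(F(A)\times B)\to A\times L(B)$ has components $\varepsilon_A\circ L(\pi_{F(A)})$ and $L(\pi_B)$. A triple $(L,F,F^\star)$ with $L\dashv F\dashv F^\star$, $F:\mathcal{F}\to\mathcal{E}$ between topoi, is an essential geometric morphism $\mathcal{E}\to\mathcal{F}$ with inverse image $F$; it is atomic if $F$ is logical, a surjection if $F$ is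 faithful, and an embedding if $F^\star$ is full and faithful. -}

module Defs where

open import Level using (Level; 0ℓ) renaming (suc to lsuc)
open import Data.Product using (Σ; Σ-syntax; ∃; _×_; _,_; proj₁; proj₂)
open import Relation.Binary.PropositionalEquality using (_≡_; refl; sym; trans; cong)
open import Relation.Nullary using (¬_)
open import Function using (_∘_; id)

-- A minimal theory of categories (objects in Set₁, hom-sets in Set,
-- hom-sets carrying an equivalence relation _≈_ used for equality of
-- morphisms; for concrete categories this is pointwise equality, since
-- Agda has no function extensionality).

record Category : Set₂ where
  infixr 9 _∘C_
  infix  4 _≈_
  field
    Obj  : Set₁
    Hom  : Obj → Obj → Set
    _≈_  : ∀ {A B} → Hom A B → Hom A B → Set
    idC  : ∀ {A} → Hom A A
    _∘C_ : ∀ {A B C} → Hom B C → Hom A B → Hom A C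
    ≈-refl  : ∀ {A B} {f : Hom A B} → f ≈ f
    ≈-sym   : ∀ {A B} {f g : Hom A B} → f ≈ g → g ≈ f
    ≈-trans : ∀ {A B} {f g h : Hom A B} → f ≈ g → g ≈ h → f ≈ h
    ∘-resp-≈ : ∀ {A B C} {f f' : Hom B C} {g g' : Hom A B} →
               f ≈ f' → g ≈ g' → (f ∘C g) ≈ (f' ∘C g')
    identityˡ : ∀ {A B} {f : Hom A B} → (idC ∘C f) ≈ f
    identityʳ : ∀ {A B} {f : Hom A B} → (f ∘C idC) ≈ f
    assoc : ∀ {A B C D} {f : Hom A B} {g : Hom B C} {h : Hom C D} →
            ((h ∘C g) ∘C f) ≈ (h ∘C (g ∘C f))

open Category public

record Functor (C D : Category) : Set₂ where
  field
    F₀ : Obj C → Obj D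
    F₁ : ∀ {A B} → Hom C A B → Hom D (F₀ A) (F₀ B)
    F-resp-≈ : ∀ {A B} {f g : Hom C A B} → _≈_ C f g → _≈_ D (F₁ f) (F₁ g)
    F-id : ∀ {A} → _≈_ D (F₁ (idC C {A})) (idC D)
    F-∘  : ∀ {A B E} {f : Hom C A B} {g : Hom C B E} →
           _≈_ D (F₁ (_∘C_ C g f)) (_∘C_ D (F₁ g) (F₁ f))

open Functor public

record Adjunction {C D : Category} (L : Functor D C) (R : Functor C D) : Set₂ where
  field
    unit   : ∀ X → Hom D X (F₀ R (F₀ L X))
    counit : ∀ A → Hom C (F₀ L (F₀ R A)) A
    unit-natural : ∀ {X Y} (f : Hom D X Y) →
      _≈_ D (_∘C_ D (unit Y) f) (_∘C_ D (F₁ R (F₁ L f)) (unit X))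
    counit-natural : ∀ {A B} (g : Hom C A B) →
      _≈_ C (_∘C_ C (counit B) (F₁ L (F₁ R g))) (_∘C_ C g (counit A))
    triangle-L : ∀ X → _≈_ C (_∘C_ C (counit (F₀ L X)) (F₁ L (unit X))) (idC C)
    triangle-R : ∀ A → _≈_ D (_∘C_ D (F₁ R (counit A)) (unit (F₀ R A))) (idC D)

open Adjunction public

Faithful : ∀ {C D} → Functor C D → Set₁
Faithful {C} {D} F = ∀ {A B} (f g : Hom C A B) → _≈_ D (F₁ F f) (F₁ F g) → _≈_ C f g

Full : ∀ {C D} → Functor C D → Set₁
Full {C} {D} F = ∀ {A B} (h : Hom D (F₀ F A) (F₀ F B)) → Σ[ f ∈ Hom C A B ] _≈_ D (F₁ F f) h

FullyFaithful : ∀ {C D} → Functor C D → Set₁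
FullyFaithful F = Full F × Faithful F

module _ (C : Category) where
  private
    infixr 9 _∙_
    _∙_ : ∀ {A B E} → Hom C B E → Hom C A B → Hom C A E
    _∙_ = _∘C_ C
    _≋_ : ∀ {A B} → Hom C A B → Hom C A B → Set
    _≋_ = _≈_ C

  IsTerminal : Obj C → Set₁
  IsTerminal T = ∀ X → Σ[ t ∈ Hom C X T ] (∀ (t' : Hom C X T) → t' ≋ t)

  IsMono : ∀ {A B} → Hom C A B → Set₁
  IsMono {A} {B} m = ∀ {X} (f g : Hom C X A) → (m ∙ f) ≋ (m ∙ g) → f ≋ g

  record IsProduct {A B P : Obj C} (p : Hom C P A) (q : Hom C P B) : Set₁ where
    field
      ⟨_,_⟩ : ∀ {X} → Hom C X A → Hom C X B → Hom C X P
      π₁-⟨⟩ : ∀ {X} {f : Hom C X A} {g : Hom C X B} → (p ∙ ⟨ f , g ⟩) ≋ f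
      π₂-⟨⟩ : ∀ {X} {f : Hom C X A} {g : Hom C X B} → (q ∙ ⟨ f , g ⟩) ≋ g
      ⟨⟩-unique : ∀ {X} {f : Hom C X A} {g : Hom C X B} (h : Hom C X P) →
                  (p ∙ h) ≋ f → (q ∙ h) ≋ g → h ≋ ⟨ f , g ⟩

  IsPullback : ∀ {P A B Z} → Hom C P A → Hom C P B → Hom C A Z → Hom C B Z → Set₁
  IsPullback {P} {A} {B} p₁ p₂ f g =
    ((f ∙ p₁) ≋ (g ∙ p₂)) ×
    (∀ {X} (h : Hom C X A) (k : Hom C X B) → (f ∙ h) ≋ (g ∙ k) →
       Σ[ u ∈ Hom C X P ] (((p₁ ∙ u) ≋ h) × ((p₂ ∙ u) ≋ k) ×
         (∀ (u' : Hom C X P) → (p₁ ∙ u') ≋ h → (p₂ ∙ u') ≋ k → u' ≋ u)))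

  IsExponential : ∀ {A B E EA : Obj C} {p : Hom C EA E} {q : Hom C EA A} →
                  IsProduct p q → Hom C EA B → Set₁
  IsExponential {A} {B} {E} {EA} {p} {q} prod ev =
    ∀ {X XA : Obj C} {r : Hom C XA X} {s : Hom C XA A} (prodX : IsProduct r s)
      (f : Hom C XA B) →
      Σ[ h ∈ Hom C X E ] ((ev ∙ IsProduct.⟨_,_⟩ prod (h ∙ r) s) ≋ f ×
        (∀ (h' : Hom C X E) → (ev ∙ IsProduct.⟨_,_⟩ prod (h' ∙ r) s) ≋ f → h' ≋ h))

  IsSubobjectClassifier : ∀ {T Ω : Obj C} → IsTerminal T → Hom C T Ω → Set₁
  IsSubobjectClassifier {T} {Ω} term true =
    ∀ {A X} (m : Hom C A X) → IsMono m →
      Σ[ χ ∈ Hom C X Ω ] (IsPullback m (proj₁ (term A)) χ true ×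
        (∀ (χ' : Hom C X Ω) → IsPullback m (proj₁ (term A)) χ' true → χ' ≋ χ))

module _ {C D : Category} (F : Functor C D) where

  PreservesTerminal : Set₁
  PreservesTerminal = ∀ T → IsTerminal C T → IsTerminal D (F₀ F T)

  PreservesProducts : Set₁
  PreservesProducts = ∀ {A B P} {p : Hom C P A} {q : Hom C P B} →
    IsProduct C p q → IsProduct D (F₁ F p) (F₁ F q)

  PreservesPullbacks : Set₁
  PreservesPullbacks = ∀ {P A B Z} (p₁ : Hom C P A) (p₂ : Hom C P B)
    (f : Hom C A Z) (g : Hom C B Z) →
    IsPullback C p₁ p₂ f g → IsPullback D (F₁ F p₁) (F₁ F p₂) (F₁ F f) (F₁ F g)

  PreservesExponentials : Set₁
  PreservesExponentials = ∀ {A B E EA} {p : Hom C EA E} {q : Hom C EA A}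
    (prod : IsProduct C p q) (ev : Hom C EA B) →
    IsExponential C prod ev →
    (prod' : IsProduct D (F₁ F p) (F₁ F q)) → IsExponential D prod' (F₁ F ev)

  PreservesSubobjectClassifier : Set₁
  PreservesSubobjectClassifier = ∀ {T Ω} (term : IsTerminal C T) (true : Hom C T Ω) →
    IsSubobjectClassifier C term true →
    (term' : IsTerminal D (F₀ F T)) → IsSubobjectClassifier D term' (F₁ F true)

  record Logical : Set₁ where
    field
      pres-terminal  : PreservesTerminal
      pres-products  : PreservesProducts
      pres-pullbacks : PreservesPullbacks
      pres-exponentials : PreservesExponentials
      pres-Ω : PreservesSubobjectClassifier

-- Essential geometric morphisms E → F given by L ⊣ F ⊣ F⋆, F : F → E.

record EssentialGeometricMorphism {𝓔 𝓕 : Category}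
  (L : Functor 𝓔 𝓕) (F : Functor 𝓕 𝓔) (F⋆ : Functor 𝓔 𝓕) : Set₂ where
  field
    L⊣F  : Adjunction L F
    F⊣F⋆ : Adjunction F F⋆

IsAtomic IsSurjection IsEmbedding : ∀ {𝓔 𝓕} {L : Functor 𝓔 𝓕} {F : Functor 𝓕 𝓔}
  {F⋆ : Functor 𝓔 𝓕} → EssentialGeometricMorphism L F F⋆ → Set₁
IsAtomic {F = F} _ = Logical F
IsSurjection {F = F} _ = Faithful F
IsEmbedding {F⋆ = F⋆} _ = FullyFaithful F⋆

SetC : Category
SetC = record
  { Obj = Set
  ; Hom = λ A B → A → B
  ; _≈_ = λ f g → ∀ x → f x ≡ g x
  ; idC = id
  ; _∘C_ = λ f g → f ∘ g
  ; ≈-refl = λ _ → refl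
  ; ≈-sym = λ p x → sym (p x)
  ; ≈-trans = λ p q x → trans (p x) (q x)
  ; ∘-resp-≈ = λ {_} {_} {_} {f} {f'} {g} {g'} p q x → trans (cong f (q x)) (p (g' x))
  ; identityˡ = λ _ → refl
  ; identityʳ = λ _ → refl
  ; assoc = λ _ → refl
  }

record HGraph : Set₁ where
  field
    V E I : Set
    ς : I → V
    ω : I → E

open HGraph public

record HMor (G H : HGraph) : Set where
  field
    fV : V G → V H
    fE : E G → E H
    fI : I G → I H
    comm-ς : ∀ i → ς H (fI i) ≡ fV (ς G i)
    comm-ω : ∀ i → ω H (fI i) ≡ fE (ω G i)

open HMor public

record _≈ᴴ_ {G H : HGraph} (f g : HMor G H) : Set where
  field
    ≈V : ∀ x → fV f x ≡ fV g x
    ≈E : ∀ x → fE f x ≡ fE g x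
    ≈I : ∀ x → fI f x ≡ fI g x

idᴴ : ∀ {G} → HMor G G
idᴴ = record { fV = id ; fE = id ; fI = id ; comm-ς = λ _ → refl ; comm-ω = λ _ → refl }

_∘ᴴ_ : ∀ {G H K} → HMor H K → HMor G H → HMor G K
_∘ᴴ_ {G} {H} {K} f g = record
  { fV = fV f ∘ fV g ; fE = fE f ∘ fE g ; fI = fI f ∘ fI g
  ; comm-ς = λ i → trans (comm-ς f (fI g i)) (cong (fV f) (comm-ς g i))
  ; comm-ω = λ i → trans (comm-ω f (fI g i)) (cong (fE f) (comm-ω g i)) }

ℜ : Category
ℜ = record
  { Obj = HGraph
  ; Hom = HMor
  ; _≈_ = _≈ᴴ_
  ; idC = idᴴ
  ; _∘C_ = _∘ᴴ_
  ; ≈-refl = record { ≈V = λ _ → refl ; ≈E = λ _ → refl ; ≈I = λ _ → refl }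
  ; ≈-sym = λ p → record { ≈V = λ x → sym (_≈ᴴ_.≈V p x)
                         ; ≈E = λ x → sym (_≈ᴴ_.≈E p x)
                         ; ≈I = λ x → sym (_≈ᴴ_.≈I p x) }
  ; ≈-trans = λ p q → record { ≈V = λ x → trans (_≈ᴴ_.≈V p x) (_≈ᴴ_.≈V q x)
                             ; ≈E = λ x → trans (_≈ᴴ_.≈E p x) (_≈ᴴ_.≈E q x)
                             ; ≈I = λ x → trans (_≈ᴴ_.≈I p x) (_≈ᴴ_.≈I q x) }
  ; ∘-resp-≈ = λ {_} {_} {_} {f} {f'} {g} {g'} p q → record
      { ≈V = λ x → trans (cong (fV f) (_≈ᴴ_.≈V q x)) (_≈ᴴ_.≈V p (fV g' x))
      ; ≈E = λ x → trans (cong (fE f) (_≈ᴴ_.≈E q x)) (_≈ᴴ_.≈E p (fE g' x))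
      ; ≈I = λ x → trans (cong (fI f) (_≈ᴴ_.≈I q x)) (_≈ᴴ_.≈I p (fI g' x)) }
  ; identityˡ = record { ≈V = λ _ → refl ; ≈E = λ _ → refl ; ≈I = λ _ → refl }
  ; identityʳ = record { ≈V = λ _ → refl ; ≈E = λ _ → refl ; ≈I = λ _ → refl }
  ; assoc = record { ≈V = λ _ → refl ; ≈E = λ _ → refl ; ≈I = λ _ → refl }
  }

_×ᴴ_ : HGraph → HGraph → HGraph
G ×ᴴ H = record
  { V = V G × V H ; E = E G × E H ; I = I G × I H
  ; ς = λ { (i , j) → ς G i , ς H j }
  ; ω = λ { (i , j) → ω G i , ω H j } }

⟨_,_⟩ᴴ : ∀ {K G H} → HMor K G → HMor K H → HMor K (G ×ᴴ H)
⟨ f , g ⟩ᴴ = record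
  { fV = λ x → fV f x , fV g x
  ; fE = λ x → fE f x , fE g x
  ; fI = λ x → fI f x , fI g x
  ; comm-ς = λ i → cong₂' (comm-ς f i) (comm-ς g i)
  ; comm-ω = λ i → cong₂' (comm-ω f i) (comm-ω g i) }
  where
    cong₂' : ∀ {A B : Set} {a a' : A} {b b' : B} → a ≡ a' → b ≡ b' → (a , b) ≡ (a' , b')
    cong₂' refl refl = refl

Iᶠ : Functor ℜ SetC
Iᶠ = record
  { F₀ = I
  ; F₁ = fI
  ; F-resp-≈ = _≈ᴴ_.≈I
  ; F-id = λ _ → refl
  ; F-∘ = λ _ → refl }

I◇₀ : Set → HGraph
I◇₀ X = record { V = X ; E = X ; I = X ; ς = id ; ω = id }

I◇ : Functor SetC ℜ
I◇ = record
  { F₀ = I◇₀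
  ; F₁ = λ f → record { fV = f ; fE = f ; fI = f
                      ; comm-ς = λ _ → refl ; comm-ω = λ _ → refl }
  ; F-resp-≈ = λ p → record { ≈V = p ; ≈E = p ; ≈I = p }
  ; F-id = record { ≈V = λ _ → refl ; ≈E = λ _ → refl ; ≈I = λ _ → refl }
  ; F-∘ = record { ≈V = λ _ → refl ; ≈E = λ _ → refl ; ≈I = λ _ → refl } }

data One : Set where
  ⋆ : One

I⋆₀ : Set → HGraph
I⋆₀ X = record { V = One ; E = One ; I = X ; ς = λ _ → ⋆ ; ω = λ _ → ⋆ }

I⋆ : Functor SetC ℜ
I⋆ = record
  { F₀ = I⋆₀
  ; F₁ = λ f → record { fV = id ; fE = id ; fI = f
                      ; comm-ς = λ _ → refl ; comm-ω = λ _ → refl }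
  ; F-resp-≈ = λ p → record { ≈V = λ _ → refl ; ≈E = λ _ → refl ; ≈I = p }
  ; F-id = record { ≈V = λ _ → refl ; ≈E = λ _ → refl ; ≈I = λ _ → refl }
  ; F-∘ = record { ≈V = λ _ → refl ; ≈E = λ _ → refl ; ≈I = λ _ → refl } }

Frobenius : Adjunction I◇ Iᶠ → (G : HGraph) (S : Set) →
            HMor (I◇₀ (I G × S)) (G ×ᴴ I◇₀ S)
Frobenius adj G S =
  ⟨ counit adj G ∘ᴴ F₁ I◇ (proj₁ {A = I G} {B = λ _ → S})
  , F₁ I◇ (proj₂ {A = I G} {B = λ _ → S}) ⟩ᴴ

Φ : (G : HGraph) (S : Set) → HMor (I◇₀ (I G × S)) (G ×ᴴ I◇₀ S)
Φ G S = record
  { fV = λ { (i , s) → ς G i , s }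
  ; fE = λ { (i , s) → ω G i , s }
  ; fI = λ p → p
  ; comm-ς = λ _ → refl
  ; comm-ω = λ _ → refl }

open EssentialGeometricMorphism public

module Submission where

-- I◇ ⊣ I : the counit at G is (ς_G, ω_G, id) : I◇(I G) → G, the unit is the
-- identity.  I ⊣ I⋆ : the unit at G collapses vertices and edges to the single
-- point of I⋆(I G), the counit is the identity.  With this counit the
-- Frobenius morphism is definitionally Φ = (ς_G × id, ω_G × id, id).
--
-- I⋆ is fully faithful: a morphism I⋆ X → I⋆ Y is determined by, and freely
-- given by, its incidence component, so the morphism is an embedding.
--
-- I is not faithful, because it forgets vertices: the two maps from a lone
-- vertex to I◇(Bool) picking different vertices are both empty on incidences.
--
-- I is not logical, because it does not preserve exponentials: in ℜ the
-- hypergraph with one edge and no vertex is the exponential ∅^• (a map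
-- X × • → ∅ exists exactly when X has no vertex), but I sends it to the
-- empty set, while in Set every B^∅ is inhabited.

open import Defs
open import Data.Product using (Σ-syntax; _×_; _,_; proj₁; proj₂)
open import Relation.Nullary using (¬_)
open import Data.Empty using (⊥; ⊥-elim)
open import Data.Bool using (Bool; true; false)
open import Relation.Binary.PropositionalEquality using (_≡_; refl; cong₂)
open import Function using (id)

One-unique : (a b : One) → a ≡ b
One-unique ⋆ ⋆ = refl

incidence-counit : (G : HGraph) → HMor (I◇₀ (I G)) G
incidence-counit G = record { fV = ς G ; fE = ω G ; fI = id
                            ; comm-ς = λ _ → refl ; comm-ω = λ _ → refl }

-- The unit X → I(I◇ X) is the identity; naturality of ε is exactly the
-- commutation of a morphism with ς and ω.
I◇⊣I : Adjunction I◇ Iᶠ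
I◇⊣I = record
  { unit = λ X x → x
  ; counit = incidence-counit
  ; unit-natural = λ f x → refl
  ; counit-natural = λ g → record { ≈V = comm-ς g ; ≈E = comm-ω g ; ≈I = λ _ → refl }
  ; triangle-L = λ X → record { ≈V = λ _ → refl ; ≈E = λ _ → refl ; ≈I = λ _ → refl }
  ; triangle-R = λ A x → refl }

collapse : (G : HGraph) → HMor G (I⋆₀ (I G))
collapse G = record { fV = λ _ → ⋆ ; fE = λ _ → ⋆ ; fI = id
                    ; comm-ς = λ _ → refl ; comm-ω = λ _ → refl }

I⊣I⋆ : Adjunction Iᶠ I⋆
I⊣I⋆ = record
  { unit = collapse
  ; counit = λ X x → x
  ; unit-natural = λ f → record { ≈V = λ _ → refl ; ≈E = λ _ → refl ; ≈I = λ _ → refl }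
  ; counit-natural = λ g x → refl
  ; triangle-L = λ G x → refl
  ; triangle-R = λ X → record { ≈V = One-unique ⋆ ; ≈E = One-unique ⋆ ; ≈I = λ _ → refl } }

essential : EssentialGeometricMorphism I◇ Iᶠ I⋆
essential = record { L⊣F = I◇⊣I ; F⊣F⋆ = I⊣I⋆ }

frobenius-explicit : (G : HGraph) (S : Set) → Frobenius I◇⊣I G S ≈ᴴ Φ G S
frobenius-explicit G S = record { ≈V = λ _ → refl ; ≈E = λ _ → refl ; ≈I = λ _ → refl }

I⋆-full : Full I⋆
I⋆-full h = fI h , record { ≈V = λ _ → One-unique _ _ ; ≈E = λ _ → One-unique _ _
                          ; ≈I = λ _ → refl }

I⋆-faithful : Faithful I⋆
I⋆-faithful f g = _≈ᴴ_.≈I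

not-faithful : ∀ {C D} (F : Functor C D) {A B} (f g : Hom C A B) →
               _≈_ D (F₁ F f) (F₁ F g) → ¬ _≈_ C f g → ¬ Faithful F
not-faithful F f g Ff≈Fg f≉g faithful = f≉g (faithful f g Ff≈Fg)

Vertex : HGraph
Vertex = record { V = One ; E = ⊥ ; I = ⊥ ; ς = λ () ; ω = λ () }

pick-vertex : Bool → HMor Vertex (I◇₀ Bool)
pick-vertex b = record { fV = λ _ → b ; fE = λ () ; fI = λ ()
                       ; comm-ς = λ () ; comm-ω = λ () }

I-not-faithful : ¬ Faithful Iᶠ
I-not-faithful = not-faithful Iᶠ (pick-vertex true) (pick-vertex false) (λ ())
                   (λ p → different (_≈ᴴ_.≈V p ⋆))
  where
    different : true ≡ false → ⊥
    different ()

π₁ᴴ : ∀ {G H} → HMor (G ×ᴴ H) G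
π₁ᴴ = record { fV = proj₁ ; fE = proj₁ ; fI = proj₁ ; comm-ς = λ _ → refl ; comm-ω = λ _ → refl }

π₂ᴴ : ∀ {G H} → HMor (G ×ᴴ H) H
π₂ᴴ = record { fV = proj₂ ; fE = proj₂ ; fI = proj₂ ; comm-ς = λ _ → refl ; comm-ω = λ _ → refl }

×ᴴ-isProduct : ∀ {G H} → IsProduct ℜ (π₁ᴴ {G} {H}) π₂ᴴ
×ᴴ-isProduct = record
  { ⟨_,_⟩ = ⟨_,_⟩ᴴ
  ; π₁-⟨⟩ = record { ≈V = λ _ → refl ; ≈E = λ _ → refl ; ≈I = λ _ → refl }
  ; π₂-⟨⟩ = record { ≈V = λ _ → refl ; ≈E = λ _ → refl ; ≈I = λ _ → refl }
  ; ⟨⟩-unique = λ h e₁ e₂ → record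
      { ≈V = λ x → cong₂ _,_ (_≈ᴴ_.≈V e₁ x) (_≈ᴴ_.≈V e₂ x)
      ; ≈E = λ x → cong₂ _,_ (_≈ᴴ_.≈E e₁ x) (_≈ᴴ_.≈E e₂ x)
      ; ≈I = λ x → cong₂ _,_ (_≈ᴴ_.≈I e₁ x) (_≈ᴴ_.≈I e₂ x) } }

×-isProduct : ∀ {A B : Set} → IsProduct SetC (proj₁ {A = A} {B = λ _ → B}) proj₂
×-isProduct = record
  { ⟨_,_⟩ = λ f g x → f x , g x
  ; π₁-⟨⟩ = λ _ → refl
  ; π₂-⟨⟩ = λ _ → refl
  ; ⟨⟩-unique = λ h e₁ e₂ x → cong₂ _,_ (e₁ x) (e₂ x) }

not-logical : ∀ {C D} (F : Functor C D) {A B E EA} {p : Hom C EA E} {q : Hom C EA A}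
  (prod : IsProduct C p q) (ev : Hom C EA B) → IsExponential C prod ev →
  (∀ (prod' : IsProduct D (F₁ F p) (F₁ F q)) → ¬ IsExponential D prod' (F₁ F ev)) →
  ¬ Logical F
not-logical {D = D} F {p = p} {q = q} prod ev isExp notExp logical =
  notExp prod' (pres-exponentials prod ev isExp prod')
  where
    open Logical logical
    prod' : IsProduct D (F₁ F p) (F₁ F q)
    prod' = pres-products prod

-- In Set, B^A is inhabited when A is empty (by the empty function), so an
-- empty set is never an exponential with empty exponent.
empty-not-exponential : ∀ {A B E EA : Set} {p : EA → E} {q : EA → A}
  (prod : IsProduct SetC p q) (ev : EA → B) →
  (A → ⊥) → (E → ⊥) → ¬ IsExponential SetC prod ev
empty-not-exponential prod ev noA noE isExp =
  noE (proj₁ (isExp ×-isProduct (λ p → ⊥-elim (noA (proj₂ p)))) ⋆)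

LooseEdge : HGraph
LooseEdge = record { V = ⊥ ; E = One ; I = ⊥ ; ς = λ () ; ω = λ _ → ⋆ }

EmptyH : HGraph
EmptyH = record { V = ⊥ ; E = ⊥ ; I = ⊥ ; ς = λ () ; ω = λ () }

into-empty-unique : ∀ {G} (f g : HMor G EmptyH) → f ≈ᴴ g
into-empty-unique f g = record { ≈V = λ x → ⊥-elim (fV f x) ; ≈E = λ x → ⊥-elim (fE f x)
                               ; ≈I = λ x → ⊥-elim (fI f x) }

into-looseEdge-unique : ∀ {G} (f g : HMor G LooseEdge) → f ≈ᴴ g
into-looseEdge-unique f g = record { ≈V = λ x → ⊥-elim (fV f x) ; ≈E = λ _ → One-unique _ _
                                   ; ≈I = λ x → ⊥-elim (fI f x) }

to-looseEdge : ∀ {G} → (V G → ⊥) → HMor G LooseEdge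
to-looseEdge {G} noV = record { fV = noV ; fE = λ _ → ⋆ ; fI = λ i → noV (ς G i)
                              ; comm-ς = λ i → ⊥-elim (noV (ς G i))
                              ; comm-ω = λ _ → refl }

-- If X × • maps to the empty hypergraph then X has no vertices: a vertex x
-- of X paired with the vertex of • would be sent to a vertex of ∅.
vertex-free : ∀ {X XA} {r : HMor XA X} {s : HMor XA Vertex} →
              IsProduct ℜ r s → HMor XA EmptyH → V X → ⊥
vertex-free prod f x = fV f (fV (IsProduct.⟨_,_⟩ prod (point x) idᴴ) ⋆)
  where
    point : ∀ {X} → V X → HMor Vertex X
    point x = record { fV = λ _ → x ; fE = λ () ; fI = λ () ; comm-ς = λ () ; comm-ω = λ () }

evaluate : HMor (LooseEdge ×ᴴ Vertex) EmptyH
evaluate = record { fV = proj₁ ; fE = proj₂ ; fI = proj₁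
                  ; comm-ς = λ p → ⊥-elim (proj₁ p) ; comm-ω = λ p → ⊥-elim (proj₁ p) }

looseEdge-exponential : IsExponential ℜ (×ᴴ-isProduct {LooseEdge} {Vertex}) evaluate
looseEdge-exponential prodX f =
  to-looseEdge (vertex-free prodX f) , into-empty-unique _ _ ,
  λ h' _ → into-looseEdge-unique h' _

I-not-logical : ¬ Logical Iᶠ
I-not-logical = not-logical Iᶠ ×ᴴ-isProduct evaluate looseEdge-exponential
                  (λ prod' → empty-not-exponential prod' (fI evaluate) (λ ()) (λ ()))

mainTheorem16 : Σ[ γ ∈ EssentialGeometricMorphism I◇ Iᶠ I⋆ ]
    (((G : HGraph) (S : Set) → Frobenius (L⊣F γ) G S ≈ᴴ Φ G S)
    × IsEmbedding γ × ¬ IsSurjection γ × ¬ IsAtomic γ)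
mainTheorem16 =
  essential , frobenius-explicit , (I⋆-full , I⋆-faithful) , I-not-faithful , I-not-logical
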